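{- Let $s\ge1$, $k\ge1$ and $n\ge sk$ be integers. Then \[ L^{(s)}(n,k)=\sum_{i=s(k-1)}^{n-s}(n-i)!\binom{n-1}{i}L^{(s)}(i,k-1). \]
   Context: For an integer $s\ge1$ and integers $n,k\ge 0$, the $s$-associated Lah number $L^{(s)}(n,k)$ is the number of partitions of $\{1,\dots,n\}$ into exactly $k$ ordered lists (i.e. $k$ nonempty blocks, each endowed with a linear order, the collection of blocks being unordered) such that each list contains at least $s$ elements. In particular $L^{(s)}(n,0)=\delta_{n,0}$. -}

module Defs where

open import Data.Nat using (ℕ; zero; suc; _≤_; _<_; _⊓_; _≟_)
open import Data.Nat.Properties using (_≤?_; _<?_)
open import Data.Fin using (Fin; toℕ)
import Data.Fin.Properties as FinP
open import Data.List using (List; []; _∷_; map; concat; concatMap; allFin; length; filter; foldr)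
open import Data.List.Relation.Unary.All using (All; all?)
open import Data.List.Relation.Unary.AllPairs using (AllPairs; allPairs?)
open import Data.List.Relation.Unary.Unique.Propositional using (Unique)
open import Data.Product using (_×_)
open import Relation.Binary.PropositionalEquality using (_≡_)
open import Relation.Nullary using (Dec; ¬?)
open import Relation.Nullary.Decidable using (_×-dec_)

-- An ordered-list partition of {0,…,n-1} into k lists, each of size ≥ s, is
-- represented canonically as the list of its blocks (each block a list = its
-- linear order), the blocks being listed in increasing order of their minima
-- (this canonical ordering represents the collection of blocks as unordered).

-- minimum of a list of naturals (default d for the empty list; never used on
-- empty blocks, since all blocks in the enumeration below are nonempty)
minList : ℕ → List ℕ → ℕ
minList d []       = d
minList d (x ∷ xs) = foldr _⊓_ x xs

blockMin : ∀ {n} → List (Fin n) → ℕ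
blockMin b = minList 0 (map toℕ b)

IsLahPartition : (s n k : ℕ) → List (List (Fin n)) → Set
IsLahPartition s n k bs =
  Unique (concat bs)
  × length (concat bs) ≡ n              -- ... and (hence) every element occurs
  × All (λ b → s ≤ length b) bs
  × length bs ≡ k
  × AllPairs _<_ (map blockMin bs)

isLahPartition? : (s n k : ℕ) → (bs : List (List (Fin n))) → Dec (IsLahPartition s n k bs)
isLahPartition? s n k bs =
  allPairs? (λ x y → ¬? (x FinP.≟ y)) (concat bs)
  ×-dec (length (concat bs) ≟ n)
  ×-dec all? (λ b → s ≤? length b) bs
  ×-dec (length bs ≟ k)
  ×-dec allPairs? _<?_ (map blockMin bs)

words : (n m : ℕ) → List (List (Fin n))
words n zero    = [] ∷ []
words n (suc m) = concatMap (λ w → map (_∷ w) (allFin n)) (words n m)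

splits : ∀ {A : Set} → List A → List (List (List A))
splits []       = [] ∷ []
splits (x ∷ xs) = concatMap (ext x) (splits xs)
  where
  ext : _ → List (List _) → List (List (List _))
  ext x []        = ((x ∷ []) ∷ []) ∷ []
  ext x (b ∷ bs)  = ((x ∷ []) ∷ b ∷ bs) ∷ ((x ∷ b) ∷ bs) ∷ []

candidates : (n : ℕ) → List (List (List (Fin n)))
candidates n = concatMap splits (words n n)

L : (s n k : ℕ) → ℕ
L s n k = length (filter (isLahPartition? s n k) (candidates n))

module Submission where

-- The recurrence  L⁽ˢ⁾(n,k) = ∑_{i=s(k-1)}^{n-s} (n-i)! C(n-1,i) L⁽ˢ⁾(i,k-1)
-- classifies partitions by the list containing the least element: when i elements
-- lie outside it, its other members are chosen in C(n-1,i) ways, it is ordered in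
-- (n-i)! ways, and the remaining i elements are partitioned into k - 1 lists.

open import Defs
open import Data.Nat using (ℕ; zero; suc; _+_; _*_; _∸_; _≤_; _<_; z≤n; s≤s; s≤s⁻¹; _!; _⊓_)
open import Data.Nat.Properties
open import Algebra.Properties.CommutativeSemigroup +-commutativeSemigroup using (interchange)
open import Data.Nat.Combinatorics using (_C_; nCk+nC[k+1]≡[n+1]C[k+1]; k>n⇒nCk≡0)
open import Data.Nat.ListAction using (sum)
open import Data.Nat.ListAction.Properties using (sum-++)
open import Data.List using (List; []; _∷_; _++_; map; concat; concatMap; filter; foldr; length; allFin; applyUpTo; take; drop)
open import Data.List.Properties using (map-++; map-∘; map-cong-local; length-++; length-map; length-tabulate; concatMap-cong; filter-notAll; ∷-injective; ∷-injectiveˡ; ∷-injectiveʳ)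
open import Data.List.Membership.Propositional using (_∈_; _∉_; find; lose)
open import Data.List.Membership.Propositional.Properties
open import Data.List.Membership.Propositional.Properties.WithK using (unique∧set⇒bag)
open import Data.List.Relation.Binary.BagAndSetEquality using (∼bag⇒↭)
open import Data.List.Relation.Binary.Permutation.Propositional.Properties using (↭-length)
open import Data.List.Relation.Binary.Subset.Propositional using (_⊆_)
open import Data.List.Relation.Unary.Any using (here; there)
open import Data.List.Relation.Unary.All as All using (All; []; _∷_)
open import Data.List.Relation.Unary.AllPairs as AllPairs using (AllPairs; []; _∷_)
import Data.List.Relation.Unary.AllPairs.Properties as AllPairsₚ
import Data.List.Relation.Unary.All.Properties as Allₚ
open import Data.List.Relation.Unary.Unique.Propositional using (Unique)
import Data.List.Relation.Unary.Unique.Propositional.Properties as Unique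
open import Data.Fin as Fin using (Fin; toℕ)
import Data.Fin.Properties as Finₚ
open import Data.Product using (∃; _×_; _,_; proj₁; proj₂)
open import Data.Sum using (_⊎_; inj₁; inj₂; map₁; map₂)
open import Data.Empty using (⊥)
open import Relation.Unary using (Decidable)
open import Function.Bundles using (mk⇔)
open import Relation.Nullary using (¬_; Dec; yes; no; ¬?; contradiction)
open import Relation.Binary.Definitions using (DecidableEquality)
open import Relation.Binary.PropositionalEquality

module _ {A B : Set} where

  ∈-concatMap-intro : {f : A → List B} {x : A} {xs : List A} {e : B} →
                      x ∈ xs → e ∈ f x → e ∈ concatMap f xs
  ∈-concatMap-intro {f} x∈ e∈ = ∈-concatMap⁺ f (lose x∈ e∈)

  ∈-concatMap-elim : (f : A → List B) {xs : List A} {e : B} →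
                     e ∈ concatMap f xs → ∃ λ x → x ∈ xs × e ∈ f x
  ∈-concatMap-elim f e∈ = find (∈-concatMap⁻ f e∈)

  -- concatMap f xs is duplicate-free when each f x is, and every element of f x
  -- determines x through a key (so different blocks are disjoint).
  concatMap-unique : ∀ {K : Set} (f : A → List B) (key : B → K) (code : A → K) →
    (∀ {x y} → code x ≡ code y → x ≡ y) → ∀ {xs} → Unique xs →
    (∀ {x} → x ∈ xs → Unique (f x)) →
    (∀ {x e} → x ∈ xs → e ∈ f x → key e ≡ code x) → Unique (concatMap f xs)
  concatMap-unique f key code code-inj {[]} [] _ _ = []
  concatMap-unique f key code code-inj {x ∷ xs} (x∉xs ∷ u) uf keyf =
    Unique.++⁺ (uf (here refl))
      (concatMap-unique f key code code-inj u (λ x∈ → uf (there x∈)) (λ x∈ → keyf (there x∈)))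
      λ { (e∈fx , e∈rest) →
            let y , y∈xs , e∈fy = ∈-concatMap-elim f e∈rest in
            All.lookup x∉xs y∈xs (code-inj (trans (sym (keyf (here refl) e∈fx)) (keyf (there y∈xs) e∈fy))) }

  length-concatMap : (f : A → List B) (xs : List A) →
                     length (concatMap f xs) ≡ sum (map (λ x → length (f x)) xs)
  length-concatMap f []       = refl
  length-concatMap f (x ∷ xs) = trans (length-++ (f x)) (cong (length (f x) +_) (length-concatMap f xs))

module _ {A : Set} where

  SameMembers : List A → List A → Set
  SameMembers xs ys = xs ⊆ ys × ys ⊆ xs

  -- Duplicate-free lists with the same members are permutations of each other.
  sameMembers-length : {xs ys : List A} → Unique xs → Unique ys → SameMembers xs ys →
                       length xs ≡ length ys
  sameMembers-length ux uy (xs⊆ys , ys⊆xs) = ↭-length (∼bag⇒↭ (unique∧set⇒bag ux uy (mk⇔ xs⊆ys ys⊆xs)))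

  unique-++⁻ : ∀ (xs : List A) {ys} → Unique (xs ++ ys) →
               Unique xs × Unique ys × (∀ {z} → z ∈ xs × z ∈ ys → ⊥)
  unique-++⁻ []       u          = [] , u , λ ()
  unique-++⁻ (x ∷ xs) (x∉ ∷ u) =
    let uxs , uys , disjoint = unique-++⁻ xs u in
      Allₚ.++⁻ˡ xs x∉ ∷ uxs , uys
    , λ { (here refl , z∈ys) → All.lookup (Allₚ.++⁻ʳ xs x∉) z∈ys refl
        ; (there z∈xs , z∈ys) → disjoint (z∈xs , z∈ys) }

  sum-cong-∈ : (f g : A → ℕ) {xs : List A} → (∀ {x} → x ∈ xs → f x ≡ g x) →
               sum (map f xs) ≡ sum (map g xs)
  sum-cong-∈ f g eq = cong sum (map-cong-local (All.tabulate eq))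

  sum-const-∈ : (f : A → ℕ) (c : ℕ) {xs : List A} → (∀ {x} → x ∈ xs → f x ≡ c) →
                sum (map f xs) ≡ length xs * c
  sum-const-∈ f c {[]}     eq = refl
  sum-const-∈ f c {x ∷ xs} eq = cong₂ _+_ (eq (here refl)) (sum-const-∈ f c (λ x∈ → eq (there x∈)))

length-allFin : ∀ n → length (allFin n) ≡ n
length-allFin n = length-tabulate {n = n} (λ i → i)

module _ {n : ℕ} where
  open import Data.List.Membership.DecPropositional (Finₚ._≟_ {n}) using (_∈?_)

  -- A duplicate-free list of n elements of Fin n contains every element: a missing
  -- z would make it as long as the proper sublist of allFin n that it spans.
  unique-covers : {xs : List (Fin n)} → Unique xs → length xs ≡ n → ∀ z → z ∈ xs
  unique-covers {xs} ux len z with z ∈? xs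
  ... | yes z∈xs = z∈xs
  ... | no  z∉xs = contradiction len (<⇒≢ (begin-strict
    length xs                         ≡⟨ sameMembers-length ux (Unique.filter⁺ (_∈? xs) (Unique.allFin⁺ n))
                                           ((λ {y} y∈ → ∈-filter⁺ (_∈? xs) (∈-allFin y) y∈)
                                           , (λ y∈ → proj₂ (∈-filter⁻ (_∈? xs) {xs = allFin n} y∈))) ⟩
    length (filter (_∈? xs) (allFin n)) <⟨ filter-notAll (_∈? xs) (allFin n) (lose (∈-allFin z) z∉xs) ⟩
    length (allFin n)                 ≡⟨ length-allFin n ⟩
    n                                 ∎))
    where open ≤-Reasoning

module _ {A : Set} where

  NonEmptyBlocks : List (List A) → Set
  NonEmptyBlocks = All (λ b → 0 < length b)

  extend : A → List (List A) → List (List (List A))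
  extend x []       = ((x ∷ []) ∷ []) ∷ []
  extend x (b ∷ bs) = ((x ∷ []) ∷ b ∷ bs) ∷ ((x ∷ b) ∷ bs) ∷ []

  splits-∷ : (x : A) (xs : List A) → splits (x ∷ xs) ≡ concatMap (extend x) (splits xs)
  splits-∷ x xs = concatMap-cong (λ { [] → refl ; (_ ∷ _) → refl }) (splits xs)

  retract : List (List A) → List (List A)
  retract ((_ ∷ [])     ∷ bs) = bs
  retract ((_ ∷ c ∷ cs) ∷ bs) = (c ∷ cs) ∷ bs
  retract _                   = []

  extend-sound : ∀ {x} bs {e} → e ∈ extend x bs →
                 concat e ≡ x ∷ concat bs × (NonEmptyBlocks bs → NonEmptyBlocks e)
  extend-sound []       (here refl)         = refl , λ _ → s≤s z≤n ∷ []
  extend-sound (b ∷ bs) (here refl)         = refl , (s≤s z≤n ∷_)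
  extend-sound (b ∷ bs) (there (here refl)) = refl , λ { (_ ∷ ne) → s≤s z≤n ∷ ne }

  extend-retract : ∀ {x} bs {e} → NonEmptyBlocks bs → e ∈ extend x bs → retract e ≡ bs
  extend-retract []             _        (here refl)         = refl
  extend-retract (b ∷ bs)       _        (here refl)         = refl
  extend-retract ((_ ∷ _) ∷ bs) _        (there (here refl)) = refl
  extend-retract ([] ∷ bs)      (() ∷ _) (there (here refl))

  extend-unique : ∀ {x} bs → NonEmptyBlocks bs → Unique (extend x bs)
  extend-unique []       _        = [] ∷ []
  extend-unique (b ∷ bs) (ne ∷ _) = (different ∷ []) ∷ [] ∷ []
    where
    different : ∀ {x} → (x ∷ []) ∷ b ∷ bs ≢ (x ∷ b) ∷ bs
    different eq = <⇒≢ ne (cong length (proj₂ (∷-injective (∷-injectiveˡ eq))))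

  splits-sound : ∀ w {bs} → bs ∈ splits w → concat bs ≡ w × NonEmptyBlocks bs
  splits-sound []       (here refl) = refl , []
  splits-sound (x ∷ xs) bs∈ with ∈-concatMap-elim (extend x) (subst (_ ∈_) (splits-∷ x xs) bs∈)
  ... | cs , cs∈ , bs∈ext =
    let concat-bs , ne-bs = extend-sound cs bs∈ext
        concat-cs , ne-cs = splits-sound xs cs∈
    in trans concat-bs (cong (x ∷_) concat-cs) , ne-bs ne-cs

  splits-unique : ∀ w → Unique (splits w)
  splits-unique []       = [] ∷ []
  splits-unique (x ∷ xs) = subst Unique (sym (splits-∷ x xs))
    (concatMap-unique (extend x) retract (λ bs → bs) (λ eq → eq) (splits-unique xs)
      (λ {bs} bs∈ → extend-unique bs (proj₂ (splits-sound xs bs∈)))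
      (λ {bs} bs∈ → extend-retract bs (proj₂ (splits-sound xs bs∈))))

  splits-complete : ∀ w bs → NonEmptyBlocks bs → concat bs ≡ w → bs ∈ splits w
  splits-complete []       []                    _        _  = here refl
  splits-complete []       ((_ ∷ _) ∷ _)         _        ()
  splits-complete (x ∷ xs) []                    _        ()
  splits-complete _        ([] ∷ _)              (() ∷ _) _
  splits-complete (x ∷ xs) ((y ∷ []) ∷ bs)       (_ ∷ ne) eq with ∷-injective eq
  ... | refl , eq′ = subst (_ ∈_) (sym (splits-∷ x xs))
                       (∈-concatMap-intro (splits-complete xs bs ne eq′) (new-block bs))
    where
    new-block : ∀ bs → ((x ∷ []) ∷ bs) ∈ extend x bs
    new-block []      = here refl
    new-block (_ ∷ _) = here refl
  splits-complete (x ∷ xs) ((y ∷ c ∷ cs) ∷ bs) (_ ∷ ne) eq with ∷-injective eq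
  ... | refl , eq′ = subst (_ ∈_) (sym (splits-∷ x xs))
                       (∈-concatMap-intro (splits-complete xs ((c ∷ cs) ∷ bs) (s≤s z≤n ∷ ne) eq′)
                                          (there (here refl)))

module _ (n : ℕ) where

  words-complete : ∀ (w : List (Fin n)) → w ∈ words n (length w)
  words-complete []      = here refl
  words-complete (a ∷ w) = ∈-concatMap-intro (words-complete w) (∈-map⁺ (_∷ w) (∈-allFin a))

  words-unique : ∀ m → Unique (words n m)
  words-unique zero    = [] ∷ []
  words-unique (suc m) = concatMap-unique (λ w → map (_∷ w) (allFin n)) (drop 1) (λ w → w) (λ eq → eq)
    (words-unique m) (λ _ → Unique.map⁺ ∷-injectiveˡ (Unique.allFin⁺ n))
    (λ _ e∈ → let _ , _ , eq = ∈-map⁻ _ e∈ in cong (drop 1) eq)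

  candidates-unique : Unique (candidates n)
  candidates-unique = concatMap-unique splits concat (λ w → w) (λ eq → eq) (words-unique n)
    (λ {w} _ → splits-unique w) (λ {w} _ bs∈ → proj₁ (splits-sound w bs∈))

  candidates-complete : ∀ bs → NonEmptyBlocks bs → length (concat bs) ≡ n → bs ∈ candidates n
  candidates-complete bs ne len =
    ∈-concatMap-intro (subst (λ m → concat bs ∈ words n m) len (words-complete (concat bs)))
                      (splits-complete (concat bs) bs ne refl)

module Arrangements {A : Set} (_≟_ : DecidableEquality A) where

  remove : A → List A → List A
  remove y = filter (λ z → ¬? (z ≟ y))

  ∈-remove⁺ : ∀ {y z L} → z ∈ L → z ≢ y → z ∈ remove y L
  ∈-remove⁺ = ∈-filter⁺ (λ z → ¬? (z ≟ _))

  ∈-remove⁻ : ∀ {y z} L → z ∈ remove y L → z ∈ L × z ≢ y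
  ∈-remove⁻ L = ∈-filter⁻ (λ z → ¬? (z ≟ _)) {xs = L}

  remove-unique : ∀ {y L} → Unique L → Unique (remove y L)
  remove-unique = Unique.filter⁺ (λ z → ¬? (z ≟ _))

  -- y ∷ remove y L has the same members as L, hence the same length.
  remove-length : ∀ {y L} → Unique L → y ∈ L → suc (length (remove y L)) ≡ length L
  remove-length {y} {L} uL y∈L = sameMembers-length
    (All.tabulate (λ z∈ z≡y → proj₂ (∈-remove⁻ L z∈) (sym z≡y)) ∷ remove-unique uL) uL
    ((λ { (here refl) → y∈L ; (there z∈) → proj₁ (∈-remove⁻ L z∈) }) , back)
    where
    back : L ⊆ y ∷ remove y L
    back {z} z∈L with z ≟ y
    ... | yes refl = here refl
    ... | no  z≢y  = there (∈-remove⁺ z∈L z≢y)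

  remove-length-suc : ∀ {m y L} → Unique L → length L ≡ suc m → y ∈ L → length (remove y L) ≡ m
  remove-length-suc uL len y∈L = suc-injective (trans (remove-length uL y∈L) len)

  -- The first argument is the length of L; it makes the recursion structural.
  mutual
    arrangements : ℕ → List A → List (List A)
    arrangements zero    L = [] ∷ []
    arrangements (suc m) L = concatMap (startingWith m L) L

    startingWith : ℕ → List A → A → List (List A)
    startingWith m L y = map (y ∷_) (arrangements m (remove y L))

  IsArrangement : List A → List A → Set
  IsArrangement B L = Unique B × SameMembers B L

  arrangements-sound : ∀ m {L B} → Unique L → length L ≡ m → B ∈ arrangements m L → IsArrangement B L
  arrangements-sound zero    {[]} _ _ (here refl) = [] , (λ ()) , (λ ())
  arrangements-sound (suc m) {L}  uL len B∈ with ∈-concatMap-elim (startingWith m L) {L} B∈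
  ... | y , y∈L , B∈′ with ∈-map⁻ (y ∷_) B∈′
  ... | B , B∈ , refl =
    let uB , B⊆ , ⊆B = arrangements-sound m (remove-unique uL) (remove-length-suc uL len y∈L) B∈
    in  (All.tabulate (λ z∈B z≡y → proj₂ (∈-remove⁻ L (B⊆ z∈B)) (sym z≡y)) ∷ uB)
      , (λ { (here refl) → y∈L ; (there z∈B) → proj₁ (∈-remove⁻ L (B⊆ z∈B)) })
      , λ {z} z∈L → case z z∈L ⊆B
    where
    case : ∀ z → z ∈ L → remove y L ⊆ B → z ∈ y ∷ B
    case z z∈L ⊆B with z ≟ y
    ... | yes refl = here refl
    ... | no  z≢y  = there (⊆B (∈-remove⁺ z∈L z≢y))

  arrangements-complete : ∀ m {L B} → Unique L → length L ≡ m → IsArrangement B L → B ∈ arrangements m L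
  arrangements-complete zero    {[]}    {[]}    _ _   _                    = here refl
  arrangements-complete zero    {[]}    {_ ∷ _} _ _   (_ , B⊆ , _)         with B⊆ (here refl)
  ... | ()
  arrangements-complete (suc m) {[]}    _ ()
  arrangements-complete (suc m) {_ ∷ _} {[]}    _ _   (_ , _ , ⊆B)         with ⊆B (here refl)
  ... | ()
  arrangements-complete (suc m) {L}     {y ∷ B} uL len (y∉B ∷ uB , B⊆ , ⊆B) =
    ∈-concatMap-intro {f = startingWith m L} (B⊆ (here refl))
      (∈-map⁺ (y ∷_) (arrangements-complete m (remove-unique uL) (remove-length-suc uL len (B⊆ (here refl)))
        (uB , (λ z∈B → ∈-remove⁺ (B⊆ (there z∈B)) (λ z≡y → All.lookup y∉B z∈B (sym z≡y)))
            , (λ z∈ → let z∈L , z≢y = ∈-remove⁻ L z∈ in tail-member (⊆B z∈L) z≢y))))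
    where
    tail-member : ∀ {z} → z ∈ y ∷ B → z ≢ y → z ∈ B
    tail-member (here z≡y) z≢y = contradiction z≡y z≢y
    tail-member (there z∈B) _  = z∈B

  arrangements-unique : ∀ m {L} → Unique L → Unique (arrangements m L)
  arrangements-unique zero    _  = [] ∷ []
  arrangements-unique (suc m) {L} uL =
    concatMap-unique (startingWith m L) (take 1) (_∷ []) ∷-injectiveˡ uL
      (λ _ → Unique.map⁺ ∷-injectiveʳ (arrangements-unique m (remove-unique uL)))
      (λ {y} _ B∈ → let _ , _ , eq = ∈-map⁻ (y ∷_) B∈ in cong (take 1) eq)

  arrangements-length : ∀ m {L} → Unique L → length L ≡ m → length (arrangements m L) ≡ m !
  arrangements-length zero    _  _   = refl
  arrangements-length (suc m) {L} uL len = begin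
    length (concatMap (startingWith m L) L)
      ≡⟨ length-concatMap (startingWith m L) L ⟩
    sum (map (λ y → length (startingWith m L y)) L)
      ≡⟨ sum-const-∈ _ (m !) (λ {y} y∈L → trans (length-map (y ∷_) (arrangements m (remove y L)))
           (arrangements-length m (remove-unique uL) (remove-length-suc uL len y∈L))) ⟩
    length L * m !
      ≡⟨ cong (_* m !) len ⟩
    suc m * m ! ∎
    where open ≡-Reasoning

  arrangement-length : ∀ {B L} → Unique L → IsArrangement B L → length B ≡ length L
  arrangement-length uL (uB , same) = sameMembers-length uB uL same

-- The weighted number of bipartitions of an m-element list, the weight h t r
-- depending on the sizes t and r of the two parts.
bipartitionSum : ℕ → (ℕ → ℕ → ℕ) → ℕ
bipartitionSum zero    h = h 0 0
bipartitionSum (suc m) h = bipartitionSum m (λ t r → h (suc t) r) + bipartitionSum m (λ t r → h t (suc r))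

module Bipartitions {A : Set} where

  addLeft addRight : A → List A × List A → List A × List A
  addLeft  y (T , R) = (y ∷ T , R)
  addRight y (T , R) = (T , y ∷ R)

  bipartitions : List A → List (List A × List A)
  bipartitions []      = ([] , []) ∷ []
  bipartitions (y ∷ X) = map (addLeft y) (bipartitions X) ++ map (addRight y) (bipartitions X)

  IsBipartition : List A → List A × List A → Set
  IsBipartition X (T , R) = (∀ {z} → z ∈ X → z ∈ T ⊎ z ∈ R) × T ⊆ X × R ⊆ X

  ∈-bipartitions-∷ : ∀ {y X p} → p ∈ bipartitions (y ∷ X) →
    ∃ λ q → q ∈ bipartitions X × (p ≡ addLeft y q ⊎ p ≡ addRight y q)
  ∈-bipartitions-∷ {y} {X} p∈ with ∈-++⁻ (map (addLeft y) (bipartitions X)) p∈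
  ... | inj₁ p∈ˡ = let q , q∈ , eq = ∈-map⁻ (addLeft y) p∈ˡ in q , q∈ , inj₁ eq
  ... | inj₂ p∈ʳ = let q , q∈ , eq = ∈-map⁻ (addRight y) p∈ʳ in q , q∈ , inj₂ eq

  bipartitions-sound : ∀ X {p} → p ∈ bipartitions X → IsBipartition X p
  bipartitions-sound []      (here refl) = (λ ()) , (λ ()) , (λ ())
  bipartitions-sound (y ∷ X) p∈ with ∈-bipartitions-∷ {y} {X} p∈
  ... | (T , R) , q∈ , inj₁ refl =
    let covers , T⊆ , R⊆ = bipartitions-sound X q∈ in
      (λ { (here eq) → inj₁ (here eq) ; (there z∈) → map₁ there (covers z∈) })
    , (λ { (here eq) → here eq ; (there z∈) → there (T⊆ z∈) })
    , (λ z∈ → there (R⊆ z∈))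
  ... | (T , R) , q∈ , inj₂ refl =
    let covers , T⊆ , R⊆ = bipartitions-sound X q∈ in
      (λ { (here eq) → inj₂ (here eq) ; (there z∈) → map₂ there (covers z∈) })
    , (λ z∈ → there (T⊆ z∈))
    , (λ { (here eq) → here eq ; (there z∈) → there (R⊆ z∈) })

  left⊆ : ∀ X {T R} → (T , R) ∈ bipartitions X → T ⊆ X
  left⊆ X p∈ = proj₁ (proj₂ (bipartitions-sound X p∈))

  right⊆ : ∀ X {T R} → (T , R) ∈ bipartitions X → R ⊆ X
  right⊆ X p∈ = proj₂ (proj₂ (bipartitions-sound X p∈))

  bipartitions-AllPairs : ∀ {Rel : A → A → Set} X {T R} → AllPairs Rel X → (T , R) ∈ bipartitions X →
                          AllPairs Rel T × AllPairs Rel R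
  bipartitions-AllPairs []      _          (here refl) = [] , []
  bipartitions-AllPairs (y ∷ X) (y~ ∷ ~X) p∈ with ∈-bipartitions-∷ {y} {X} p∈
  ... | (T , R) , q∈ , inj₁ refl =
    let ~T , ~R = bipartitions-AllPairs X ~X q∈ in
    All.tabulate (λ z∈T → All.lookup y~ (left⊆ X q∈ z∈T)) ∷ ~T , ~R
  ... | (T , R) , q∈ , inj₂ refl =
    let ~T , ~R = bipartitions-AllPairs X ~X q∈ in
    ~T , All.tabulate (λ z∈R → All.lookup y~ (right⊆ X q∈ z∈R)) ∷ ~R

  bipartitions-disjoint : ∀ X {T R z} → Unique X → (T , R) ∈ bipartitions X → z ∈ T → z ∈ R → ⊥
  bipartitions-disjoint []      _  (here refl) ()
  bipartitions-disjoint (y ∷ X) uX p∈ z∈T z∈R with ∈-bipartitions-∷ {y} {X} p∈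
  bipartitions-disjoint (y ∷ X) uX       p∈ (here refl) z∈R | (T , R) , q∈ , inj₁ refl =
    Unique.Unique[x∷xs]⇒x∉xs uX (right⊆ X q∈ z∈R)
  bipartitions-disjoint (y ∷ X) (_ ∷ uX) p∈ (there z∈T) z∈R | (T , R) , q∈ , inj₁ refl =
    bipartitions-disjoint X uX q∈ z∈T z∈R
  bipartitions-disjoint (y ∷ X) uX       p∈ z∈T (here refl) | (T , R) , q∈ , inj₂ refl =
    Unique.Unique[x∷xs]⇒x∉xs uX (left⊆ X q∈ z∈T)
  bipartitions-disjoint (y ∷ X) (_ ∷ uX) p∈ z∈T (there z∈R) | (T , R) , q∈ , inj₂ refl =
    bipartitions-disjoint X uX q∈ z∈T z∈R

  bipartitions-filter : ∀ {P : A → Set} (P? : Decidable P) X →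
                        (filter P? X , filter (λ z → ¬? (P? z)) X) ∈ bipartitions X
  bipartitions-filter P? []      = here refl
  bipartitions-filter P? (y ∷ X) with P? y
  ... | yes _ = ∈-++⁺ˡ (∈-map⁺ (addLeft y) (bipartitions-filter P? X))
  ... | no  _ = ∈-++⁺ʳ (map (addLeft y) (bipartitions X)) (∈-map⁺ (addRight y) (bipartitions-filter P? X))

  bipartitions-determined : ∀ {P : A → Set} (P? : Decidable P) X {T R} → Unique X →
    (T , R) ∈ bipartitions X → (∀ {z} → z ∈ X → P z → z ∈ T) → (∀ {z} → z ∈ T → P z) →
    (filter P? X , filter (λ z → ¬? (P? z)) X) ≡ (T , R)
  bipartitions-determined P? []      _  (here refl) _ _ = refl
  bipartitions-determined P? (y ∷ X) uX p∈ P⇒T T⇒P with ∈-bipartitions-∷ {y} {X} p∈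
  ... | (T , R) , q∈ , inj₁ refl with P? y
  ...   | no ¬Py = contradiction (T⇒P (here refl)) ¬Py
  ...   | yes _  = cong (λ p → y ∷ proj₁ p , proj₂ p)
      (bipartitions-determined P? X (AllPairs.tail uX) q∈ (λ z∈X Pz → from-tail z∈X (P⇒T (there z∈X) Pz)) (λ z∈T → T⇒P (there z∈T)))
    where
    from-tail : ∀ {z} → z ∈ X → z ∈ y ∷ T → z ∈ T
    from-tail z∈X (here refl) = contradiction z∈X (Unique.Unique[x∷xs]⇒x∉xs uX)
    from-tail _   (there z∈T) = z∈T
  bipartitions-determined P? (y ∷ X) uX p∈ P⇒T T⇒P | (T , R) , q∈ , inj₂ refl with P? y
  ...   | yes Py = contradiction (left⊆ X q∈ (P⇒T (here refl) Py)) (Unique.Unique[x∷xs]⇒x∉xs uX)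
  ...   | no  _  = cong (λ p → proj₁ p , y ∷ proj₂ p)
      (bipartitions-determined P? X (AllPairs.tail uX) q∈ (λ z∈X Pz → P⇒T (there z∈X) Pz) T⇒P)

  bipartitions-unique : ∀ X → Unique X → Unique (bipartitions X)
  bipartitions-unique []      _  = [] ∷ []
  bipartitions-unique (y ∷ X) uX = Unique.++⁺
    (Unique.map⁺ (λ eq → cong (λ p → drop 1 (proj₁ p) , proj₂ p) eq) (bipartitions-unique X (AllPairs.tail uX)))
    (Unique.map⁺ (λ eq → cong (λ p → proj₁ p , drop 1 (proj₂ p)) eq) (bipartitions-unique X (AllPairs.tail uX)))
    λ { (p∈ˡ , p∈ʳ) →
      let q , _ , eqˡ = ∈-map⁻ (addLeft y) p∈ˡ
          (T′ , R′) , q′∈ , eqʳ = ∈-map⁻ (addRight y) p∈ʳ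
          y∈T′ = subst (y ∈_) (cong proj₁ (trans (sym eqˡ) eqʳ)) (here refl)
      in Unique.Unique[x∷xs]⇒x∉xs uX (left⊆ X q′∈ y∈T′) }

  bipartitions-sum : ∀ X (h : ℕ → ℕ → ℕ) →
    sum (map (λ p → h (length (proj₁ p)) (length (proj₂ p))) (bipartitions X)) ≡ bipartitionSum (length X) h
  bipartitions-sum []      h = +-identityʳ (h 0 0)
  bipartitions-sum (y ∷ X) h = begin
    sum (map H (map (addLeft y) B ++ map (addRight y) B))
      ≡⟨ cong sum (map-++ H (map (addLeft y) B) (map (addRight y) B)) ⟩
    sum (map H (map (addLeft y) B) ++ map H (map (addRight y) B))
      ≡⟨ sum-++ (map H (map (addLeft y) B)) (map H (map (addRight y) B)) ⟩
    sum (map H (map (addLeft y) B)) + sum (map H (map (addRight y) B))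
      ≡⟨ cong₂ _+_ (cong sum (sym (map-∘ B))) (cong sum (sym (map-∘ B))) ⟩
    sum (map (λ p → H (addLeft y p)) B) + sum (map (λ p → H (addRight y p)) B)
      ≡⟨ cong₂ _+_ (bipartitions-sum X (λ t r → h (suc t) r)) (bipartitions-sum X (λ t r → h t (suc r))) ⟩
    bipartitionSum (length X) (λ t r → h (suc t) r) + bipartitionSum (length X) (λ t r → h t (suc r)) ∎
    where
    open ≡-Reasoning
    B : List (List A × List A)
    B = bipartitions X
    H : List A × List A → ℕ
    H p = h (length (proj₁ p)) (length (proj₂ p))

guard : ∀ {P B : Set} → Dec P → List B → List B
guard (yes _) l = l
guard (no  _) l = []

guardℕ : ∀ {P : Set} → Dec P → ℕ → ℕ
guardℕ (yes _) x = x
guardℕ (no  _) x = 0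

module _ {P B : Set} where

  ∈-guard⁻ : (d : Dec P) {l : List B} {e : B} → e ∈ guard d l → P × e ∈ l
  ∈-guard⁻ (yes p) e∈ = p , e∈

  ∈-guard⁺ : (d : Dec P) {l : List B} {e : B} → P → e ∈ l → e ∈ guard d l
  ∈-guard⁺ (yes _) _ e∈ = e∈
  ∈-guard⁺ (no ¬p) p _  = contradiction p ¬p

  guard-unique : (d : Dec P) {l : List B} → Unique l → Unique (guard d l)
  guard-unique (yes _) u = u
  guard-unique (no  _) _ = []

  length-guard : (d : Dec P) (l : List B) → length (guard d l) ≡ guardℕ d (length l)
  length-guard (yes _) _ = refl
  length-guard (no  _) _ = refl

module _ {P : Set} where

  guardℕ-yes : (d : Dec P) {x : ℕ} → P → guardℕ d x ≡ x
  guardℕ-yes (yes _) _ = refl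
  guardℕ-yes (no ¬p) p = contradiction p ¬p

  guardℕ-no : (d : Dec P) {x : ℕ} → ¬ P → guardℕ d x ≡ 0
  guardℕ-no (yes p) ¬p = contradiction p ¬p
  guardℕ-no (no _)  _  = refl

  guardℕ-0 : (d : Dec P) → guardℕ d 0 ≡ 0
  guardℕ-0 (yes _) = refl
  guardℕ-0 (no _)  = refl

-- The number of canonical partitions of an m-element set into k lists of
-- length ≥ s: the first list is x ∷ T for a bipartition (T , R) of the
-- remaining m - 1 elements, arranged in (suc |T|)! ways.
lahCount : ℕ → ℕ → ℕ → ℕ
lahCount s zero    zero    = 1
lahCount s zero    (suc k) = 0
lahCount s (suc m) zero    = 0
lahCount s (suc m) (suc k) =
  bipartitionSum m (λ t r → guardℕ (s ≤? suc t) (suc t ! * lahCount s r k))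

⊓-fold-≤ : ∀ x as {a} → a ∈ x ∷ as → foldr _⊓_ x as ≤ a
⊓-fold-≤ x []       (here refl)         = ≤-refl
⊓-fold-≤ x (b ∷ as) (here refl)         = ≤-trans (m⊓n≤n b _) (⊓-fold-≤ x as (here refl))
⊓-fold-≤ x (b ∷ as) (there (here refl)) = m⊓n≤m b _
⊓-fold-≤ x (b ∷ as) (there (there a∈))  = ≤-trans (m⊓n≤n b _) (⊓-fold-≤ x as (there a∈))

module _ {n : ℕ} where

  blockMin-≤ : ∀ {b : List (Fin n)} {y} → y ∈ b → blockMin b ≤ toℕ y
  blockMin-≤ {c ∷ b} y∈ = ⊓-fold-≤ (toℕ c) (map toℕ b) (∈-map⁺ toℕ y∈)

  blockMin-∈ : ∀ {b : List (Fin n)} → 0 < length b → ∃ λ y → y ∈ b × blockMin b ≡ toℕ y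
  blockMin-∈ {c ∷ b} _ with foldr-selective ⊓-sel (toℕ c) (map toℕ b)
  ... | inj₁ eq = c , here refl , eq
  ... | inj₂ ∈b = let y , y∈ , eq = ∈-map⁻ toℕ ∈b in y , there y∈ , eq

module CanonicalPartitions (s : ℕ) (s≥1 : 1 ≤ s) (n : ℕ) where
  open Arrangements (Finₚ._≟_ {n})
  open Bipartitions {Fin n}
  open import Data.List.Membership.DecPropositional (Finₚ._≟_ {n}) using (_∈?_)

  Elem : Set
  Elem = Fin n

  Sorted : List Elem → Set
  Sorted = AllPairs Fin._<_

  sorted-unique : ∀ {X} → Sorted X → Unique X
  sorted-unique = AllPairs.map Finₚ.<⇒≢

  head-≤ : ∀ {x X y} → Sorted (x ∷ X) → y ∈ x ∷ X → toℕ x ≤ toℕ y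
  head-≤ _          (here refl) = ≤-refl
  head-≤ (x< ∷ _) (there y∈X) = <⇒≤ (All.lookup x< y∈X)

  head-∉ : ∀ {x X} → Sorted (x ∷ X) → x ∉ X
  head-∉ sX = Unique.Unique[x∷xs]⇒x∉xs (sorted-unique sX)

  IsCanonical : ℕ → List Elem → List (List Elem) → Set
  IsCanonical k X bs = Unique (concat bs) × SameMembers (concat bs) X
                     × All (λ b → s ≤ length b) bs × length bs ≡ k × AllPairs _<_ (map blockMin bs)

  mutual
    canonicalPartitions : ℕ → List Elem → List (List (List Elem))
    canonicalPartitions zero    []      = [] ∷ []
    canonicalPartitions zero    (_ ∷ _) = []
    canonicalPartitions (suc k) []      = []
    canonicalPartitions (suc k) (x ∷ X) = concatMap (withFirstList k x) (bipartitions X)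

    withFirstList : ℕ → Elem → List Elem × List Elem → List (List (List Elem))
    withFirstList k x (T , R) = guard (s ≤? suc (length T))
      (concatMap (headedBy k R) (arrangements (suc (length T)) (x ∷ T)))

    headedBy : ℕ → List Elem → List Elem → List (List (List Elem))
    headedBy k R π = map (π ∷_) (canonicalPartitions k R)

  ∈-withFirstList⁻ : ∀ {k x T R e} → e ∈ withFirstList k x (T , R) →
    s ≤ suc (length T) × ∃ λ π → ∃ λ rest →
      π ∈ arrangements (suc (length T)) (x ∷ T) × rest ∈ canonicalPartitions k R × e ≡ π ∷ rest
  ∈-withFirstList⁻ {k} {x} {T} {R} e∈ =
    let s≤ , e∈′          = ∈-guard⁻ (s ≤? suc (length T)) e∈
        π , π∈ , e∈π      = ∈-concatMap-elim (headedBy k R) e∈′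
        rest , rest∈ , eq = ∈-map⁻ (π ∷_) e∈π
    in s≤ , π , rest , π∈ , rest∈ , eq

  first-unique : ∀ {x X T R} → Sorted (x ∷ X) → (T , R) ∈ bipartitions X → Unique (x ∷ T)
  first-unique {X = X} (x< ∷ sX) p∈ = sorted-unique
    (All.tabulate (λ z∈T → All.lookup x< (left⊆ X p∈ z∈T))
      ∷ proj₁ (bipartitions-AllPairs X sX p∈))

  rest-sorted : ∀ {x X T R} → Sorted (x ∷ X) → (T , R) ∈ bipartitions X → Sorted R
  rest-sorted {X = X} (_ ∷ sX) p∈ = proj₂ (bipartitions-AllPairs X sX p∈)

  cons-canonical : ∀ {k x X T R π rest} → Sorted (x ∷ X) → (T , R) ∈ bipartitions X →
    IsArrangement π (x ∷ T) → s ≤ length π → IsCanonical k R rest →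
    IsCanonical (suc k) (x ∷ X) (π ∷ rest)
  cons-canonical {k} {x} {X} {T} {R} {π} {rest} sX p∈ (uπ , π⊆ , ⊆π) s≤π
                 (u-rest , (rest⊆ , ⊆rest) , long , len , ordered) =
      Unique.++⁺ uπ u-rest disjoint , (members⊆ , ⊆members) , s≤π ∷ long , cong suc len
    , Allₚ.map⁺ (All.tabulate first-least) ∷ ordered
    where
    covers : ∀ {z} → z ∈ X → z ∈ T ⊎ z ∈ R
    covers = proj₁ (bipartitions-sound X p∈)
    T⊆X : T ⊆ X
    T⊆X = left⊆ X p∈
    R⊆X : R ⊆ X
    R⊆X = right⊆ X p∈

    disjoint : ∀ {z} → z ∈ π × z ∈ concat rest → ⊥
    disjoint (z∈π , z∈rest) with π⊆ z∈π
    ... | here refl = head-∉ sX (R⊆X (rest⊆ z∈rest))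
    ... | there z∈T = bipartitions-disjoint X (sorted-unique (AllPairs.tail sX)) p∈ z∈T (rest⊆ z∈rest)

    members⊆ : π ++ concat rest ⊆ x ∷ X
    members⊆ z∈ with ∈-++⁻ π z∈
    ... | inj₂ z∈rest = there (R⊆X (rest⊆ z∈rest))
    ... | inj₁ z∈π with π⊆ z∈π
    ...   | here z≡x  = here z≡x
    ...   | there z∈T = there (T⊆X z∈T)

    ⊆members : x ∷ X ⊆ π ++ concat rest
    ⊆members (here z≡x)  = ∈-++⁺ˡ (⊆π (here z≡x))
    ⊆members (there z∈X) with covers z∈X
    ... | inj₁ z∈T = ∈-++⁺ˡ (⊆π (there z∈T))
    ... | inj₂ z∈R = ∈-++⁺ʳ π (⊆rest z∈R)

    -- x lies in π and is smaller than every element of the other lists.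
    first-least : ∀ {b} → b ∈ rest → blockMin π < blockMin b
    first-least {b} b∈ =
      let y , y∈b , eq = blockMin-∈ (≤-trans s≥1 (All.lookup long b∈))
      in ≤-<-trans (blockMin-≤ (⊆π (here refl)))
           (subst (toℕ x <_) (sym eq) (All.lookup (AllPairs.head sX) (R⊆X (rest⊆ (∈-concat⁺′ y∈b b∈)))))

  canonicalPartitions-sound : ∀ k X {bs} → Sorted X → bs ∈ canonicalPartitions k X → IsCanonical k X bs
  canonicalPartitions-sound zero    []      _  (here refl) = [] , ((λ ()) , (λ ())) , [] , refl , []
  canonicalPartitions-sound (suc k) (x ∷ X) sX bs∈
    with ∈-concatMap-elim (withFirstList k x) {bipartitions X} bs∈
  ... | (T , R) , p∈ , bs∈′ with ∈-withFirstList⁻ {k} {x} {T} {R} bs∈′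
  ... | s≤ , π , rest , π∈ , rest∈ , refl =
    let π-arr = arrangements-sound (suc (length T)) (first-unique sX p∈) refl π∈
    in cons-canonical sX p∈ π-arr (subst (s ≤_) (sym (arrangement-length (first-unique sX p∈) π-arr)) s≤)
         (canonicalPartitions-sound k R (rest-sorted sX p∈) rest∈)

  least-in-first : ∀ {k x X B rest} → Sorted (x ∷ X) → IsCanonical k (x ∷ X) (B ∷ rest) → x ∈ B
  least-in-first {x = x} {B = B} {rest} sX (_ , (members⊆ , ⊆members) , (s≤B ∷ _) , _ , (B< ∷ _))
    with ∈-++⁻ B (⊆members (here refl))
  ... | inj₁ x∈B    = x∈B
  ... | inj₂ x∈rest =
    let C , x∈C , C∈ = ∈-concat⁻′ rest x∈rest
        y , y∈B , eq = blockMin-∈ {b = B} (≤-trans s≥1 s≤B)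
    in contradiction (begin-strict
         toℕ x       ≤⟨ head-≤ sX (members⊆ (∈-++⁺ˡ y∈B)) ⟩
         toℕ y       ≡⟨ sym eq ⟩
         blockMin B  <⟨ All.lookup (Allₚ.map⁻ B<) C∈ ⟩
         blockMin C  ≤⟨ blockMin-≤ x∈C ⟩
         toℕ x       ∎) (<-irrefl refl)
    where open ≤-Reasoning

  firstListSplit : List Elem → List Elem → List Elem × List Elem
  firstListSplit B X = filter (_∈? B) X , filter (λ z → ¬? (z ∈? B)) X

  uncons-canonical : ∀ {k x X B rest} → Sorted (x ∷ X) → IsCanonical (suc k) (x ∷ X) (B ∷ rest) →
    IsArrangement B (x ∷ proj₁ (firstListSplit B X)) × s ≤ length B
      × IsCanonical k (proj₂ (firstListSplit B X)) rest
  uncons-canonical {k} {x} {X} {B} {rest} sX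
                   canon@(u , (members⊆ , ⊆members) , (s≤B ∷ long) , len , (_ ∷ ordered)) =
      (uB , B⊆ , ⊆B) , s≤B , (u-rest , (rest⊆ , ⊆rest) , long , suc-injective len , ordered)
    where
    uB : Unique B
    uB = proj₁ (unique-++⁻ B u)
    u-rest : Unique (concat rest)
    u-rest = proj₁ (proj₂ (unique-++⁻ B u))
    disj : ∀ {z} → z ∈ B × z ∈ concat rest → ⊥
    disj = proj₂ (proj₂ (unique-++⁻ B u))

    B⊆ : B ⊆ x ∷ filter (_∈? B) X
    B⊆ z∈B with members⊆ (∈-++⁺ˡ z∈B)
    ... | here z≡x  = here z≡x
    ... | there z∈X = there (∈-filter⁺ (_∈? B) z∈X z∈B)

    ⊆B : x ∷ filter (_∈? B) X ⊆ B
    ⊆B (here refl) = least-in-first sX canon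
    ⊆B (there z∈T) = proj₂ (∈-filter⁻ (_∈? B) {xs = X} z∈T)

    rest⊆ : concat rest ⊆ filter (λ z → ¬? (z ∈? B)) X
    rest⊆ z∈rest with members⊆ (∈-++⁺ʳ B z∈rest)
    ... | here refl = contradiction (least-in-first sX canon , z∈rest) disj
    ... | there z∈X = ∈-filter⁺ (λ z → ¬? (z ∈? B)) z∈X (λ z∈B → disj (z∈B , z∈rest))

    ⊆rest : filter (λ z → ¬? (z ∈? B)) X ⊆ concat rest
    ⊆rest z∈R with ∈-filter⁻ (λ z → ¬? (z ∈? B)) {xs = X} z∈R
    ... | z∈X , z∉B with ∈-++⁻ B (⊆members (there z∈X))
    ...   | inj₁ z∈B    = contradiction z∈B z∉B
    ...   | inj₂ z∈rest = z∈rest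

  canonicalPartitions-complete : ∀ k X {bs} → Sorted X → IsCanonical k X bs → bs ∈ canonicalPartitions k X
  canonicalPartitions-complete zero    []      {[]}    _ _                            = here refl
  canonicalPartitions-complete zero    _       {_ ∷ _} _ (_ , _ , _ , () , _)
  canonicalPartitions-complete zero    (x ∷ X) {[]}    _ (_ , (_ , ⊆members) , _)     with ⊆members (here refl)
  ... | ()
  canonicalPartitions-complete (suc k) _       {[]}    _ (_ , _ , _ , () , _)
  canonicalPartitions-complete (suc k) []      {[] ∷ _} _ (_ , _ , (s≤0 ∷ _) , _)      with ≤-trans s≥1 s≤0
  ... | ()
  canonicalPartitions-complete (suc k) []      {(_ ∷ _) ∷ _} _ (_ , (members⊆ , _) , _) with members⊆ (here refl)
  ... | ()
  canonicalPartitions-complete (suc k) (x ∷ X) {B ∷ rest} sX canon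
    with uncons-canonical sX canon
  ... | B-arr , s≤B , rest-canon =
    ∈-concatMap-intro {f = withFirstList k x} (bipartitions-filter (_∈? B) X)
      (∈-guard⁺ (s ≤? suc (length T)) (subst (s ≤_) (arrangement-length (first-unique sX T,R∈) B-arr) s≤B)
        (∈-concatMap-intro (arrangements-complete (suc (length T)) (first-unique sX T,R∈) refl B-arr)
          (∈-map⁺ (B ∷_) (canonicalPartitions-complete k R
             (rest-sorted sX T,R∈) rest-canon))))
    where
    T R : List Elem
    T = proj₁ (firstListSplit B X)
    R = proj₂ (firstListSplit B X)
    T,R∈ : (T , R) ∈ bipartitions X
    T,R∈ = bipartitions-filter (_∈? B) X

  -- No partition is generated twice: the first list determines the bipartition.
  firstList : List (List Elem) → List Elem
  firstList []      = []
  firstList (b ∷ _) = b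

  canonicalPartitions-unique : ∀ k X → Sorted X → Unique (canonicalPartitions k X)
  canonicalPartitions-unique zero    []      _  = [] ∷ []
  canonicalPartitions-unique zero    (_ ∷ _) _  = []
  canonicalPartitions-unique (suc k) []      _  = []
  canonicalPartitions-unique (suc k) (x ∷ X) sX =
    concatMap-unique (withFirstList k x) (λ bs → firstListSplit (firstList bs) X) (λ p → p) (λ eq → eq)
      (bipartitions-unique X uX) withFirstList-unique withFirstList-key
    where
    uX : Unique X
    uX = sorted-unique (AllPairs.tail sX)

    withFirstList-unique : ∀ {p} → p ∈ bipartitions X → Unique (withFirstList k x p)
    withFirstList-unique {T , R} p∈ = guard-unique (s ≤? suc (length T))
      (concatMap-unique (headedBy k R) firstList (λ π → π) (λ eq → eq)
        (arrangements-unique (suc (length T)) (first-unique sX p∈))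
        (λ _ → Unique.map⁺ ∷-injectiveʳ
                 (canonicalPartitions-unique k R (rest-sorted sX p∈)))
        (λ {π} _ e∈ → cong firstList (proj₂ (proj₂ (∈-map⁻ (π ∷_) e∈)))))

    withFirstList-key : ∀ {p e} → p ∈ bipartitions X → e ∈ withFirstList k x p →
                        firstListSplit (firstList e) X ≡ p
    withFirstList-key {T , R} p∈ e∈ with ∈-withFirstList⁻ {k} {x} {T} {R} e∈
    ... | _ , π , _ , π∈ , _ , refl =
      bipartitions-determined (_∈? π) X uX p∈ (λ z∈X z∈π → in-tail z∈X (π⊆ z∈π)) (λ z∈T → ⊆π (there z∈T))
      where
      π⊆ : π ⊆ x ∷ T
      π⊆ = proj₁ (proj₂ (arrangements-sound (suc (length T)) (first-unique sX p∈) refl π∈))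
      ⊆π : x ∷ T ⊆ π
      ⊆π = proj₂ (proj₂ (arrangements-sound (suc (length T)) (first-unique sX p∈) refl π∈))
      in-tail : ∀ {z} → z ∈ X → z ∈ x ∷ T → z ∈ T
      in-tail z∈X (here refl) = contradiction z∈X (head-∉ sX)
      in-tail _   (there z∈T) = z∈T

  canonicalPartitions-length : ∀ k X → Sorted X → length (canonicalPartitions k X) ≡ lahCount s (length X) k
  canonicalPartitions-length zero    []      _  = refl
  canonicalPartitions-length zero    (_ ∷ _) _  = refl
  canonicalPartitions-length (suc k) []      _  = refl
  canonicalPartitions-length (suc k) (x ∷ X) sX = begin
    length (concatMap (withFirstList k x) (bipartitions X))
      ≡⟨ length-concatMap (withFirstList k x) (bipartitions X) ⟩
    sum (map (λ p → length (withFirstList k x p)) (bipartitions X))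
      ≡⟨ sum-cong-∈ _ _ withFirstList-length ⟩
    sum (map (λ p → weight (length (proj₁ p)) (length (proj₂ p))) (bipartitions X))
      ≡⟨ bipartitions-sum X weight ⟩
    bipartitionSum (length X) weight ∎
    where
    open ≡-Reasoning
    weight : ℕ → ℕ → ℕ
    weight t r = guardℕ (s ≤? suc t) (suc t ! * lahCount s r k)

    withFirstList-length : ∀ {p} → p ∈ bipartitions X →
                           length (withFirstList k x p) ≡ weight (length (proj₁ p)) (length (proj₂ p))
    withFirstList-length {T , R} p∈ = begin
      length (withFirstList k x (T , R))
        ≡⟨ length-guard (s ≤? suc (length T)) (concatMap (headedBy k R) arrs) ⟩
      guardℕ (s ≤? suc (length T)) (length (concatMap (headedBy k R) arrs))
        ≡⟨ cong (guardℕ (s ≤? suc (length T))) arranged-count ⟩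
      weight (length T) (length R) ∎
      where
      arrs : List (List Elem)
      arrs = arrangements (suc (length T)) (x ∷ T)

      -- Each of the (|T| + 1)! arrangements heads the same number of partitions.
      arranged-count : length (concatMap (headedBy k R) arrs) ≡ suc (length T) ! * lahCount s (length R) k
      arranged-count = begin
        length (concatMap (headedBy k R) arrs)
          ≡⟨ length-concatMap (headedBy k R) arrs ⟩
        sum (map (λ π → length (headedBy k R π)) arrs)
          ≡⟨ sum-const-∈ _ _ {arrs} (λ {π} _ → trans (length-map (π ∷_) (canonicalPartitions k R))
               (canonicalPartitions-length k R (rest-sorted sX p∈))) ⟩
        length arrs * lahCount s (length R) k
          ≡⟨ cong (_* lahCount s (length R) k) (arrangements-length (suc (length T)) (first-unique sX p∈) refl) ⟩
        suc (length T) ! * lahCount s (length R) k ∎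

  allFin-sorted : Sorted (allFin n)
  allFin-sorted = AllPairsₚ.tabulate⁺-< (λ i<j → i<j)

  lah⇒canonical : ∀ {k bs} → IsLahPartition s n k bs → IsCanonical k (allFin n) bs
  lah⇒canonical (u , len , long , k≡ , ordered) =
    u , ((λ {z} _ → ∈-allFin z) , (λ {z} _ → unique-covers u len z)) , long , k≡ , ordered

  canonical⇒lah : ∀ {k bs} → IsCanonical k (allFin n) bs → IsLahPartition s n k bs
  canonical⇒lah (u , same , long , k≡ , ordered) =
    u , trans (sameMembers-length u (Unique.allFin⁺ n) same) (length-allFin n) , long , k≡ , ordered

  L≡lahCount : ∀ k → L s n k ≡ lahCount s n k
  L≡lahCount k = begin
    length (filter (isLahPartition? s n k) (candidates n))
      ≡⟨ sameMembers-length (Unique.filter⁺ (isLahPartition? s n k) (candidates-unique n))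
           (canonicalPartitions-unique k (allFin n) allFin-sorted) (lah⊆ , ⊆lah) ⟩
    length (canonicalPartitions k (allFin n))
      ≡⟨ canonicalPartitions-length k (allFin n) allFin-sorted ⟩
    lahCount s (length (allFin n)) k
      ≡⟨ cong (λ m → lahCount s m k) (length-allFin n) ⟩
    lahCount s n k ∎
    where
    open ≡-Reasoning
    lah⊆ : filter (isLahPartition? s n k) (candidates n) ⊆ canonicalPartitions k (allFin n)
    lah⊆ bs∈ = canonicalPartitions-complete k (allFin n) allFin-sorted
      (lah⇒canonical (proj₂ (∈-filter⁻ (isLahPartition? s n k) {xs = candidates n} bs∈)))

    ⊆lah : canonicalPartitions k (allFin n) ⊆ filter (isLahPartition? s n k) (candidates n)
    ⊆lah {bs} bs∈ =
      let lah@(_ , len , long , _) = canonical⇒lah (canonicalPartitions-sound k (allFin n) allFin-sorted bs∈)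
      in ∈-filter⁺ (isLahPartition? s n k) (candidates-complete n bs (All.map (≤-trans s≥1) long) len) lah

∑ : ℕ → (ℕ → ℕ) → ℕ
∑ zero    f = 0
∑ (suc c) f = f 0 + ∑ c (λ j → f (suc j))

∑-cong : ∀ c {f g : ℕ → ℕ} → (∀ j → j < c → f j ≡ g j) → ∑ c f ≡ ∑ c g
∑-cong zero    eq = refl
∑-cong (suc c) eq = cong₂ _+_ (eq 0 (s≤s z≤n)) (∑-cong c (λ j j<c → eq (suc j) (s≤s j<c)))

∑-zero : ∀ c {f : ℕ → ℕ} → (∀ j → j < c → f j ≡ 0) → ∑ c f ≡ 0
∑-zero zero    _    = refl
∑-zero (suc c) vanish = cong₂ _+_ (vanish 0 (s≤s z≤n)) (∑-zero c (λ j j<c → vanish (suc j) (s≤s j<c)))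

∑-+ : ∀ a b (f : ℕ → ℕ) → ∑ (a + b) f ≡ ∑ a f + ∑ b (λ j → f (a + j))
∑-+ zero    b f = refl
∑-+ (suc a) b f = trans (cong (f 0 +_) (∑-+ a b (λ j → f (suc j)))) (sym (+-assoc (f 0) _ _))

∑-distrib : ∀ c (f g : ℕ → ℕ) → ∑ c (λ j → f j + g j) ≡ ∑ c f + ∑ c g
∑-distrib zero    f g = refl
∑-distrib (suc c) f g = trans
  (cong (f 0 + g 0 +_) (∑-distrib c (λ j → f (suc j)) (λ j → g (suc j))))
  (interchange (f 0) (g 0) (∑ c (λ j → f (suc j))) (∑ c (λ j → g (suc j))))

∑-snoc : ∀ c (f : ℕ → ℕ) → ∑ (suc c) f ≡ ∑ c f + f c
∑-snoc c f = begin
  ∑ (suc c) f              ≡⟨ cong (λ m → ∑ m f) (+-comm 1 c) ⟩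
  ∑ (c + 1) f              ≡⟨ ∑-+ c 1 f ⟩
  ∑ c f + (f (c + 0) + 0)  ≡⟨ cong (∑ c f +_) (trans (+-identityʳ _) (cong f (+-identityʳ c))) ⟩
  ∑ c f + f c              ∎
  where open ≡-Reasoning

∑-window : ∀ N a c (f : ℕ → ℕ) → a + c ≤ N → (∀ i → i < a → f i ≡ 0) → (∀ i → a + c ≤ i → i < N → f i ≡ 0) →
           ∑ N f ≡ ∑ c (λ j → f (a + j))
∑-window N a c f a+c≤N below above = begin
  ∑ N f                                               ≡⟨ cong (λ m → ∑ m f) (sym N≡) ⟩
  ∑ (a + c + d) f                                     ≡⟨ ∑-+ (a + c) d f ⟩
  ∑ (a + c) f + ∑ d (λ j → f (a + c + j))             ≡⟨ cong₂ _+_ (∑-+ a c f) (∑-zero d beyond) ⟩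
  ∑ a f + ∑ c (λ j → f (a + j)) + 0                   ≡⟨ +-identityʳ _ ⟩
  ∑ a f + ∑ c (λ j → f (a + j))                       ≡⟨ cong (_+ ∑ c (λ j → f (a + j))) (∑-zero a below) ⟩
  ∑ c (λ j → f (a + j))                               ∎
  where
  open ≡-Reasoning
  d : ℕ
  d = N ∸ (a + c)
  N≡ : a + c + d ≡ N
  N≡ = m+[n∸m]≡n a+c≤N
  beyond : ∀ j → j < d → f (a + c + j) ≡ 0
  beyond j j<d = above (a + c + j) (m≤m+n (a + c) j) (subst (a + c + j <_) N≡ (+-monoʳ-< (a + c) j<d))

sum-applyUpTo : ∀ (f g : ℕ → ℕ) c → sum (map f (applyUpTo g c)) ≡ ∑ c (λ j → f (g j))
sum-applyUpTo f g zero    = refl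
sum-applyUpTo f g (suc c) = cong (f (g 0) +_) (sum-applyUpTo f (λ j → g (suc j)) c)

-- Counting bipartitions by the size i of the second part gives binomial coefficients.
bipartitionSum-binomial : ∀ m (h : ℕ → ℕ → ℕ) → bipartitionSum m h ≡ ∑ (suc m) (λ i → (m C i) * h (m ∸ i) i)
bipartitionSum-binomial zero    h = sym (trans (+-identityʳ ((0 C 0) * h 0 0)) (*-identityˡ (h 0 0)))
bipartitionSum-binomial (suc m) h = begin
  bipartitionSum m (λ t r → h (suc t) r) + bipartitionSum m (λ t r → h t (suc r))
    ≡⟨ cong₂ _+_ (bipartitionSum-binomial m (λ t r → h (suc t) r)) (bipartitionSum-binomial m (λ t r → h t (suc r))) ⟩
  ∑ (suc m) (λ i → (m C i) * h (suc (m ∸ i)) i) + ∑ (suc m) lower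
    ≡⟨ cong (_+ ∑ (suc m) lower) first-part ⟩
  h (suc m) 0 + ∑ (suc m) upper + ∑ (suc m) lower
    ≡⟨ +-assoc (h (suc m) 0) (∑ (suc m) upper) (∑ (suc m) lower) ⟩
  h (suc m) 0 + (∑ (suc m) upper + ∑ (suc m) lower)
    ≡⟨ cong (h (suc m) 0 +_) (trans (+-comm (∑ (suc m) upper) (∑ (suc m) lower)) (sym (∑-distrib (suc m) lower upper))) ⟩
  h (suc m) 0 + ∑ (suc m) (λ i → lower i + upper i)
    ≡⟨ cong₂ _+_ (sym (*-identityˡ (h (suc m) 0))) (∑-cong (suc m) (λ i _ → pascal i)) ⟩
  ∑ (suc (suc m)) (λ i → (suc m C i) * h (suc m ∸ i) i) ∎
  where
  open ≡-Reasoning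
  H : ℕ → ℕ
  H i = h (m ∸ i) (suc i)
  lower upper : ℕ → ℕ
  lower i = (m C i) * H i
  upper i = (m C suc i) * H i

  pascal : ∀ i → lower i + upper i ≡ (suc m C suc i) * H i
  pascal i = trans (sym (*-distribʳ-+ (H i) (m C i) (m C suc i))) (cong (_* H i) (nCk+nC[k+1]≡[n+1]C[k+1] m i))

  -- Shifting the index of the first sum; its last term has the factor m C (m + 1) = 0.
  first-part : ∑ (suc m) (λ i → (m C i) * h (suc (m ∸ i)) i) ≡ h (suc m) 0 + ∑ (suc m) upper
  first-part = cong₂ _+_ (*-identityˡ (h (suc m) 0)) (begin
    ∑ m (λ j → (m C suc j) * h (suc (m ∸ suc j)) (suc j))
      ≡⟨ ∑-cong m (λ j j<m → cong (λ t → (m C suc j) * h t (suc j)) (suc-∸ j<m)) ⟩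
    ∑ m upper
      ≡⟨ +-identityʳ (∑ m upper) ⟨
    ∑ m upper + 0
      ≡⟨ cong (λ c → ∑ m upper + c * H m) (k>n⇒nCk≡0 (n<1+n m)) ⟨
    ∑ m upper + upper m
      ≡⟨ ∑-snoc m upper ⟨
    ∑ (suc m) upper ∎)
    where
    suc-∸ : ∀ {j} → j < m → suc (m ∸ suc j) ≡ m ∸ j
    suc-∸ j<m = sym (+-∸-assoc 1 j<m)

bipartitionSum-zero : ∀ m (h : ℕ → ℕ → ℕ) → (∀ t r → t + r ≡ m → h t r ≡ 0) → bipartitionSum m h ≡ 0
bipartitionSum-zero zero    h vanish = vanish 0 0 refl
bipartitionSum-zero (suc m) h vanish = cong₂ _+_
  (bipartitionSum-zero m _ (λ t r t+r≡m → vanish (suc t) r (cong suc t+r≡m)))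
  (bipartitionSum-zero m _ (λ t r t+r≡m → vanish t (suc r) (trans (+-suc t r) (cong suc t+r≡m))))

lahCount-vanishes : ∀ s k i → i < s * k → lahCount s i k ≡ 0
lahCount-vanishes s zero    i       i<0  = contradiction (subst (i <_) (*-zeroʳ s) i<0) n≮0
lahCount-vanishes s (suc k) zero    _    = refl
lahCount-vanishes s (suc k) (suc m) m<sk = bipartitionSum-zero m _ vanish
  where
  vanish : ∀ t r → t + r ≡ m → guardℕ (s ≤? suc t) (suc t ! * lahCount s r k) ≡ 0
  vanish t r t+r≡m with s ≤? suc t
  ... | no  _   = refl
  ... | yes s≤t = trans (cong (suc t ! *_) (lahCount-vanishes s k r r<sk)) (*-zeroʳ (suc t !))
    where
    r<sk : r < s * k
    r<sk = +-cancelˡ-< s r (s * k) (begin-strict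
      s + r      ≤⟨ +-monoˡ-≤ r s≤t ⟩
      suc t + r  ≡⟨ cong suc t+r≡m ⟩
      suc m      <⟨ m<sk ⟩
      s * suc k  ≡⟨ *-suc s k ⟩
      s + s * k  ∎)
      where open ≤-Reasoning

swap-∸ : ∀ {i j m} → i ≤ m → j ≤ m ∸ i → i ≤ m ∸ j
swap-∸ {i} {j} {m} i≤m j≤m∸i = m+n≤o⇒m≤o∸n i (subst (_≤ m) (+-comm j i) (m≤o∸n⇒m+n≤o j i≤m j≤m∸i))

-- The recursion of lahCount as a sum over the size i of the elements outside the
-- first list, restricted to the sizes s·k ≤ i ≤ n - s that actually occur (n = m + 1).
lahCount-recurrence : ∀ s′ k m → suc s′ * suc k ≤ suc m →
  lahCount (suc s′) (suc m) (suc k) ≡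
    ∑ (suc (suc m ∸ suc s′) ∸ suc s′ * k)
      (λ j → ((suc m ∸ (suc s′ * k + j)) !) * (m C (suc s′ * k + j)) * lahCount (suc s′) (suc s′ * k + j) k)
lahCount-recurrence s′ k m sk≤n = begin
  bipartitionSum m weight           ≡⟨ bipartitionSum-binomial m weight ⟩
  ∑ (suc m) F                       ≡⟨ ∑-window (suc m) a c F window≤n too-few too-short ⟩
  ∑ c (λ j → F (a + j))             ≡⟨ ∑-cong c (λ j j<c → F≡term (in-window j j<c)) ⟩
  ∑ c (λ j → term (a + j))          ∎
  where
  open ≡-Reasoning
  s a c : ℕ
  s = suc s′
  a = s * k
  c = suc (m ∸ s′) ∸ a

  weight : ℕ → ℕ → ℕ
  weight t r = guardℕ (s ≤? suc t) (suc t ! * lahCount s r k)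
  F term : ℕ → ℕ
  F i    = (m C i) * weight (m ∸ i) i
  term i = ((suc m ∸ i) !) * (m C i) * lahCount s i k

  a+s≤n : a + s ≤ suc m
  a+s≤n = subst (_≤ suc m) (trans (*-suc s k) (+-comm s a)) sk≤n
  s′≤m : s′ ≤ m
  s′≤m = s≤s⁻¹ (≤-trans (m≤n+m s a) a+s≤n)
  a+c≡ : a + c ≡ suc (m ∸ s′)
  a+c≡ = m+[n∸m]≡n (m≤n⇒m≤1+n (m+n≤o⇒m≤o∸n a a+s≤n))
  window≤n : a + c ≤ suc m
  window≤n = subst (_≤ suc m) (sym a+c≡) (s≤s (m∸n≤m m s′))

  -- Below the window the remaining elements are too few for k lists.
  too-few : ∀ i → i < a → F i ≡ 0
  too-few i i<a = begin
    (m C i) * guardℕ (s ≤? suc (m ∸ i)) (suc (m ∸ i) ! * lahCount s i k)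
      ≡⟨ cong (λ x → (m C i) * guardℕ (s ≤? suc (m ∸ i)) (suc (m ∸ i) ! * x)) (lahCount-vanishes s k i i<a) ⟩
    (m C i) * guardℕ (s ≤? suc (m ∸ i)) (suc (m ∸ i) ! * 0)
      ≡⟨ cong (λ x → (m C i) * guardℕ (s ≤? suc (m ∸ i)) x) (*-zeroʳ (suc (m ∸ i) !)) ⟩
    (m C i) * guardℕ (s ≤? suc (m ∸ i)) 0
      ≡⟨ cong ((m C i) *_) (guardℕ-0 (s ≤? suc (m ∸ i))) ⟩
    (m C i) * 0
      ≡⟨ *-zeroʳ (m C i) ⟩
    0 ∎

  -- Above the window the first list would be shorter than s.
  too-short : ∀ i → a + c ≤ i → i < suc m → F i ≡ 0
  too-short i a+c≤i (s≤s i≤m) = trans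
    (cong ((m C i) *_) (guardℕ-no (s ≤? suc (m ∸ i)) λ { (s≤s s′≤m∸i) →
       <⇒≱ (subst (_≤ i) a+c≡ a+c≤i) (swap-∸ i≤m s′≤m∸i) }))
    (*-zeroʳ (m C i))

  in-window : ∀ j → j < c → a + j ≤ m ∸ s′
  in-window j j<c = s≤s⁻¹ (subst (a + j <_) a+c≡ (+-monoʳ-< a j<c))

  F≡term : ∀ {i} → i ≤ m ∸ s′ → F i ≡ term i
  F≡term {i} i≤ = begin
    (m C i) * guardℕ (s ≤? suc (m ∸ i)) (suc (m ∸ i) ! * lahCount s i k)
      ≡⟨ cong ((m C i) *_) (guardℕ-yes (s ≤? suc (m ∸ i)) (s≤s (swap-∸ s′≤m i≤))) ⟩
    (m C i) * (suc (m ∸ i) ! * lahCount s i k)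
      ≡⟨ cong (λ t → (m C i) * (t ! * lahCount s i k)) (sym (+-∸-assoc 1 (≤-trans i≤ (m∸n≤m m s′)))) ⟩
    (m C i) * ((suc m ∸ i) ! * lahCount s i k)
      ≡⟨ *-assoc (m C i) ((suc m ∸ i) !) (lahCount s i k) ⟨
    (m C i) * (suc m ∸ i) ! * lahCount s i k
      ≡⟨ cong (_* lahCount s i k) (*-comm (m C i) ((suc m ∸ i) !)) ⟩
    term i ∎

mainTheorem3 : (s k n : ℕ) → 1 ≤ s → 1 ≤ k → s * k ≤ n →
    L s n k ≡
      sum (map (λ i → ((n ∸ i) !) * ((n ∸ 1) C i) * L s i (k ∸ 1))
               (applyUpTo (λ j → s * (k ∸ 1) + j) (suc (n ∸ s) ∸ s * (k ∸ 1))))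
mainTheorem3 zero     _       _       ()  _  _
mainTheorem3 (suc _)  zero    _       _   () _
mainTheorem3 (suc _)  (suc _) zero    _   _  ()
mainTheorem3 (suc s′) (suc k) (suc m) s≥1 _  sk≤n = begin
  L s n (suc k)                     ≡⟨ L≡lahCount s s≥1 n (suc k) ⟩
  lahCount s n (suc k)              ≡⟨ lahCount-recurrence s′ k m sk≤n ⟩
  ∑ c (λ j → term lahCount (a + j)) ≡⟨ ∑-cong c (λ j _ → cong (summand (a + j)) (sym (L≡lahCount s s≥1 (a + j) k))) ⟩
  ∑ c (λ j → term L (a + j))        ≡⟨ sum-applyUpTo (term L) (a +_) c ⟨
  sum (map (term L) (applyUpTo (a +_) c)) ∎
  where
  open ≡-Reasoning
  open CanonicalPartitions using (L≡lahCount)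
  s n a c : ℕ
  s = suc s′
  n = suc m
  a = s * k
  c = suc (n ∸ s) ∸ a
  summand : ℕ → ℕ → ℕ
  summand i x = ((n ∸ i) !) * (m C i) * x
  term : (ℕ → ℕ → ℕ → ℕ) → ℕ → ℕ
  term count i = summand i (count s i k)
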